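{- For every integer $n\ge 0$ and any $y$, \[ \sum_{r=0}^{n}(-1)^{r}d_{r}\,\tilde{w}_{n,r}(y)=\frac{w_{n}(y)+w_{n}(-y)}{2}. \] In particular, \[ \sum_{r=0}^{n}(-1)^{r}d_{r}\tilde{w}_{n,r}=\sum_{r=0}^{n}(-1)^{r}d_{r}\tilde{w}_{n,r}(-1)=\frac{w_{n}+(-1)^{n}}{2}. \]
   Context: ${n\brace k}$ denotes the Stirling number of the second kind. $w_n(y)=\sum_{k=0}^n{n\brace k}k!y^k$ and $w_n=w_n(1)$ (ordered Bell numbers). $d_m=m!\sum_{i=0}^m(-1)^i/i!$ is the number of derangements of an $m$-set; $d_{k,r}=\binom{k}{r}d_{k-r}$ for $k\ge r$, $0$ otherwise. $\tilde{w}_{n,r}(y)=\sum_{k=0}^n{n\brace k}d_{k,r}y^k$ and $\tilde{w}_{n,r}=\tilde{w}_{n,r}(1)$. -}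

module Defs where

open import Data.Nat as ℕ using (ℕ; zero; suc)
open import Data.Nat.Base using (_!)
open import Data.Nat.Combinatorics using (_C_)
open import Data.Nat.Properties using (_!≢0)
open import Data.Bool using (true; false)
open import Data.Integer as ℤ using (ℤ; +_)
open import Data.Rational as ℚ using (ℚ; 0ℚ; 1ℚ)

sumℤ : ℕ → (ℕ → ℤ) → ℤ
sumℤ zero    f = f 0
sumℤ (suc n) f = sumℤ n f ℤ.+ f (suc n)

sumℚ : ℕ → (ℕ → ℚ) → ℚ
sumℚ zero    f = f 0
sumℚ (suc n) f = sumℚ n f ℚ.+ f (suc n)

_^ℚ_ : ℚ → ℕ → ℚ
x ^ℚ zero  = 1ℚ
x ^ℚ suc k = x ℚ.* (x ^ℚ k)

sgn : ℕ → ℤ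
sgn i = ℤ.-1ℤ ℤ.^ i

S2 : ℕ → ℕ → ℕ
S2 zero    zero    = 1
S2 zero    (suc k) = 0
S2 (suc n) zero    = 0
S2 (suc n) (suc k) = suc k ℕ.* S2 n (suc k) ℕ.+ S2 n k

-- d_m = m! Σ_{i=0}^m (-1)^i / i!  =  Σ_{i=0}^m (-1)^i (m!/i!)   (exact division, i ≤ m)
der : ℕ → ℤ
der m = sumℤ m (λ i → sgn i ℤ.* (+ (ℕ._/_ (m !) (i !) {{i !≢0}})))

derKR : ℕ → ℕ → ℤ
derKR k r with r ℕ.≤ᵇ k
... | true  = + (k C r) ℤ.* der (k ℕ.∸ r)
... | false = + 0

w : ℕ → ℚ → ℚ
w n y = sumℚ n (λ k → ℚ._/_ (+ (S2 n k ℕ.* k !)) 1 ℚ.* (y ^ℚ k))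

wBell : ℕ → ℚ
wBell n = w n 1ℚ

wt : ℕ → ℕ → ℚ → ℚ
wt n r y = sumℚ n (λ k → ℚ._/_ (+ S2 n k ℤ.* derKR k r) 1 ℚ.* (y ^ℚ k))

wtOne : ℕ → ℕ → ℚ
wtOne n r = wt n r 1ℚ

toℚ : ℤ → ℚ
toℚ z = ℚ._/_ z 1

-- Put a r = (-1)^r d r. Exchanging the two sums, the coefficient of {n brace k} y^k on the
-- left is T k = Σ_r C(k,r) a r d (k-r). The recurrence d (m+1) = (m+1) d m + (-1)^(m+1)
-- gives T (k+1) = (k+1) T k + (-1)^(k+1) Σ_r C(k+1,r) d r, and Σ_r C(m,r) d r = m!, so
-- T k = k! when k is even and 0 otherwise; with exponential generating functions this is
-- e^x/(1+x) · e^(-x)/(1-x) = 1/(1-x²). Hence the left side keeps exactly the even-degree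
-- part of w n y. At y = -1 the recurrence of k! {n brace k} makes the alternating sum
-- Σ_k k! {n brace k} (-1)^k telescope to minus its value for n - 1, so w n (-1) = (-1)^n.
module Submission where

open import Defs
open import Algebra.Bundles using (CommutativeRing)
open import Data.Bool.Base using (Bool; true; false)
open import Data.Nat.Base as ℕ using (ℕ; zero; suc; _≤_; _<_; z≤n; s≤s; _∸_; _!)
import Data.Nat.Properties as ℕ
open import Data.Nat.Properties using (_!≢0)
open import Data.Nat.Combinatorics using (_C_; nC1≡n; nCk≡nC[n∸k]; k>n⇒nCk≡0; nCk+nC[k+1]≡[n+1]C[k+1])
open import Data.Nat.Divisibility using (m≤n⇒m!∣n!)
open import Data.Nat.DivMod using (*-/-assoc; n/n≡1)
import Data.Nat.Tactic.RingSolver as ℕ-Solver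
open import Data.Integer.Base as ℤ using (ℤ; +_; -1ℤ; 0ℤ; 1ℤ)
import Data.Integer.Properties as ℤ
import Data.Integer.Tactic.RingSolver as ℤ-Solver
open import Data.Sum using (inj₁; inj₂)
open import Relation.Nullary.Decidable using (dec-true; dec-false)
open import Relation.Binary.PropositionalEquality as ≡ using (_≡_; cong; cong₂; sym; trans)

module FiniteSum {c ℓ} (R : CommutativeRing c ℓ) where

  open CommutativeRing R hiding (sym; trans)

  module Properties (sum : ℕ → (ℕ → Carrier) → Carrier)
                    (sum-zero : ∀ f → sum 0 f ≈ f 0)
                    (sum-suc : ∀ n f → sum (suc n) f ≈ sum n f + f (suc n))
                    where

    open import Algebra.Properties.CommutativeSemigroup +-commutativeSemigroup using (interchange)
    open import Relation.Binary.Reasoning.Setoid setoid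

    sum-cong : ∀ n {f g} → (∀ i → i ≤ n → f i ≈ g i) → sum n f ≈ sum n g
    sum-cong zero    {f} {g} f≈g = begin
      sum 0 f ≈⟨ sum-zero f ⟩
      f 0     ≈⟨ f≈g 0 z≤n ⟩
      g 0     ≈⟨ sum-zero g ⟨
      sum 0 g ∎
    sum-cong (suc n) {f} {g} f≈g = begin
      sum (suc n) f       ≈⟨ sum-suc n f ⟩
      sum n f + f (suc n) ≈⟨ +-cong (sum-cong n (λ i i≤n → f≈g i (ℕ.m≤n⇒m≤1+n i≤n))) (f≈g (suc n) ℕ.≤-refl) ⟩
      sum n g + g (suc n) ≈⟨ sum-suc n g ⟨
      sum (suc n) g       ∎

    sum-distrib-+ : ∀ n f g → sum n (λ i → f i + g i) ≈ sum n f + sum n g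
    sum-distrib-+ zero    f g = begin
      sum 0 (λ i → f i + g i) ≈⟨ sum-zero _ ⟩
      f 0 + g 0               ≈⟨ +-cong (sum-zero f) (sum-zero g) ⟨
      sum 0 f + sum 0 g       ∎
    sum-distrib-+ (suc n) f g = begin
      sum (suc n) (λ i → f i + g i)                  ≈⟨ sum-suc n _ ⟩
      sum n (λ i → f i + g i) + (f (suc n) + g (suc n)) ≈⟨ +-congʳ (sum-distrib-+ n f g) ⟩
      (sum n f + sum n g) + (f (suc n) + g (suc n))  ≈⟨ interchange _ _ _ _ ⟩
      (sum n f + f (suc n)) + (sum n g + g (suc n))  ≈⟨ +-cong (sum-suc n f) (sum-suc n g) ⟨
      sum (suc n) f + sum (suc n) g                  ∎

    *-distribˡ-sum : ∀ n x f → x * sum n f ≈ sum n (λ i → x * f i)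
    *-distribˡ-sum zero    x f = begin
      x * sum 0 f ≈⟨ *-congˡ (sum-zero f) ⟩
      x * f 0     ≈⟨ sum-zero _ ⟨
      sum 0 (λ i → x * f i) ∎
    *-distribˡ-sum (suc n) x f = begin
      x * sum (suc n) f                         ≈⟨ *-congˡ (sum-suc n f) ⟩
      x * (sum n f + f (suc n))                 ≈⟨ distribˡ x _ _ ⟩
      x * sum n f + x * f (suc n)               ≈⟨ +-congʳ (*-distribˡ-sum n x f) ⟩
      sum n (λ i → x * f i) + x * f (suc n)     ≈⟨ sum-suc n _ ⟨
      sum (suc n) (λ i → x * f i)               ∎

    *-distribʳ-sum : ∀ n x f → sum n f * x ≈ sum n (λ i → f i * x)
    *-distribʳ-sum n x f = begin
      sum n f * x           ≈⟨ *-comm _ x ⟩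
      x * sum n f           ≈⟨ *-distribˡ-sum n x f ⟩
      sum n (λ i → x * f i) ≈⟨ sum-cong n (λ i _ → *-comm x (f i)) ⟩
      sum n (λ i → f i * x) ∎

    sum-shift : ∀ n f → sum (suc n) f ≈ f 0 + sum n (λ i → f (suc i))
    sum-shift zero    f = begin
      sum 1 f         ≈⟨ sum-suc 0 f ⟩
      sum 0 f + f 1   ≈⟨ +-congʳ (sum-zero f) ⟩
      f 0 + f 1       ≈⟨ +-congˡ (sum-zero _) ⟨
      f 0 + sum 0 (λ i → f (suc i)) ∎
    sum-shift (suc n) f = begin
      sum (suc (suc n)) f                                  ≈⟨ sum-suc (suc n) f ⟩
      sum (suc n) f + f (suc (suc n))                      ≈⟨ +-congʳ (sum-shift n f) ⟩
      (f 0 + sum n (λ i → f (suc i))) + f (suc (suc n))    ≈⟨ +-assoc _ _ _ ⟩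
      f 0 + (sum n (λ i → f (suc i)) + f (suc (suc n)))    ≈⟨ +-congˡ (sum-suc n _) ⟨
      f 0 + sum (suc n) (λ i → f (suc i))                  ∎

    sum-comm : ∀ n m (f : ℕ → ℕ → Carrier) →
               sum n (λ i → sum m (f i)) ≈ sum m (λ j → sum n (λ i → f i j))
    sum-comm zero    m f = begin
      sum 0 (λ i → sum m (f i))          ≈⟨ sum-zero _ ⟩
      sum m (f 0)                        ≈⟨ sum-cong m (λ j _ → sum-zero _) ⟨
      sum m (λ j → sum 0 (λ i → f i j))  ∎
    sum-comm (suc n) m f = begin
      sum (suc n) (λ i → sum m (f i))                          ≈⟨ sum-suc n _ ⟩
      sum n (λ i → sum m (f i)) + sum m (f (suc n))            ≈⟨ +-congʳ (sum-comm n m f) ⟩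
      sum m (λ j → sum n (λ i → f i j)) + sum m (f (suc n))    ≈⟨ sum-distrib-+ m _ _ ⟨
      sum m (λ j → sum n (λ i → f i j) + f (suc n) j)          ≈⟨ sum-cong m (λ j _ → sum-suc n _) ⟨
      sum m (λ j → sum (suc n) (λ i → f i j))                  ∎

    sum-truncate : ∀ {k n} f → k ≤ n → (∀ i → k < i → f i ≈ 0#) → sum n f ≈ sum k f
    sum-truncate {n = zero}  f z≤n _ = refl
    sum-truncate {k} {suc n} f k≤1+n f≈0 with ℕ.m≤n⇒m<n∨m≡n k≤1+n
    ... | inj₂ ≡.refl = refl
    ... | inj₁ k<1+n = begin
      sum (suc n) f       ≈⟨ sum-suc n f ⟩
      sum n f + f (suc n) ≈⟨ +-cong (sum-truncate f (ℕ.≤-pred k<1+n) f≈0) (f≈0 (suc n) k<1+n) ⟩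
      sum k f + 0#        ≈⟨ +-identityʳ _ ⟩
      sum k f             ∎

    sum-telescope : ∀ n (f : ℕ → Carrier) → sum n (λ i → f (suc i) - f i) ≈ f (suc n) - f 0
    sum-telescope zero    f = sum-zero _
    sum-telescope (suc n) f = begin
      sum (suc n) (λ i → f (suc i) - f i)                   ≈⟨ sum-suc n _ ⟩
      sum n (λ i → f (suc i) - f i) + (f (2 ℕ.+ n) - f (suc n)) ≈⟨ +-congʳ (sum-telescope n f) ⟩
      (f (suc n) - f 0) + (f (2 ℕ.+ n) - f (suc n))             ≈⟨ +-comm _ _ ⟩
      (f (2 ℕ.+ n) - f (suc n)) + (f (suc n) - f 0)             ≈⟨ +-assoc _ _ _ ⟩
      f (2 ℕ.+ n) + (- f (suc n) + (f (suc n) - f 0))           ≈⟨ +-congˡ (+-assoc _ _ _) ⟨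
      f (2 ℕ.+ n) + ((- f (suc n) + f (suc n)) - f 0)           ≈⟨ +-congˡ (+-congʳ (-‿inverseˡ _)) ⟩
      f (2 ℕ.+ n) + (0# - f 0)                                  ≈⟨ +-congˡ (+-identityˡ _) ⟩
      f (2 ℕ.+ n) - f 0                                         ∎

    sum-*-sum : ∀ n m (c : ℕ → Carrier) (a : ℕ → ℕ → Carrier) (x : ℕ → Carrier) →
                sum n (λ r → c r * sum m (λ k → a r k * x k))
                  ≈ sum m (λ k → sum n (λ r → c r * a r k) * x k)
    sum-*-sum n m c a x = begin
      sum n (λ r → c r * sum m (λ k → a r k * x k))    ≈⟨ sum-cong n (λ r _ → *-distribˡ-sum m (c r) _) ⟩
      sum n (λ r → sum m (λ k → c r * (a r k * x k)))  ≈⟨ sum-comm n m _ ⟩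
      sum m (λ k → sum n (λ r → c r * (a r k * x k)))  ≈⟨ sum-cong m (λ k _ → sum-cong n (λ r _ → *-assoc _ _ _)) ⟨
      sum m (λ k → sum n (λ r → c r * a r k * x k))    ≈⟨ sum-cong m (λ k _ → *-distribʳ-sum n (x k) _) ⟨
      sum m (λ k → sum n (λ r → c r * a r k) * x k)    ∎

open ≡.≡-Reasoning

[n+1]C[k+1]*[k+1]≡[n+1]*nCk : ∀ n k → (suc n C suc k) ℕ.* suc k ≡ suc n ℕ.* (n C k)
[n+1]C[k+1]*[k+1]≡[n+1]*nCk zero    zero    = ≡.refl
[n+1]C[k+1]*[k+1]≡[n+1]*nCk zero    (suc k) = ≡.refl
[n+1]C[k+1]*[k+1]≡[n+1]*nCk (suc n) zero    = trans (ℕ.*-identityʳ _) (trans (nC1≡n (2 ℕ.+ n)) (sym (ℕ.*-identityʳ _)))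
[n+1]C[k+1]*[k+1]≡[n+1]*nCk (suc n) (suc k) = begin
  (suc (suc n) C suc (suc k)) ℕ.* (2 ℕ.+ k)
    ≡⟨ cong (ℕ._* (2 ℕ.+ k)) (nCk+nC[k+1]≡[n+1]C[k+1] (suc n) (suc k)) ⟨
  (a ℕ.+ b) ℕ.* (2 ℕ.+ k)
    ≡⟨ split-factor k a b ⟩
  a ℕ.+ a ℕ.* suc k ℕ.+ b ℕ.* (2 ℕ.+ k)
    ≡⟨ cong₂ (λ x y → a ℕ.+ x ℕ.+ y) ([n+1]C[k+1]*[k+1]≡[n+1]*nCk n k) ([n+1]C[k+1]*[k+1]≡[n+1]*nCk n (suc k)) ⟩
  a ℕ.+ suc n ℕ.* (n C k) ℕ.+ suc n ℕ.* (n C suc k)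
    ≡⟨ ℕ.+-assoc a _ _ ⟩
  a ℕ.+ (suc n ℕ.* (n C k) ℕ.+ suc n ℕ.* (n C suc k))
    ≡⟨ cong (a ℕ.+_) (ℕ.*-distribˡ-+ (suc n) (n C k) (n C suc k)) ⟨
  a ℕ.+ suc n ℕ.* (n C k ℕ.+ n C suc k)
    ≡⟨ cong (λ t → a ℕ.+ suc n ℕ.* t) (nCk+nC[k+1]≡[n+1]C[k+1] n k) ⟩
  (2 ℕ.+ n) ℕ.* a ∎
  where
  a b : ℕ
  a = suc n C suc k
  b = suc n C suc (suc k)
  split-factor : ∀ k a b → (a ℕ.+ b) ℕ.* (2 ℕ.+ k) ≡ a ℕ.+ a ℕ.* suc k ℕ.+ b ℕ.* (2 ℕ.+ k)
  split-factor = ℕ-Solver.solve-∀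

[n+1]Ck*[n-k+1]≡[n+1]*nCk : ∀ {n k} → k ≤ n → (suc n C k) ℕ.* suc (n ∸ k) ≡ suc n ℕ.* (n C k)
[n+1]Ck*[n-k+1]≡[n+1]*nCk {n} {k} k≤n = begin
  (suc n C k) ℕ.* suc (n ∸ k)             ≡⟨ cong (ℕ._* suc (n ∸ k)) (nCk≡nC[n∸k] (ℕ.m≤n⇒m≤1+n k≤n)) ⟩
  (suc n C (suc n ∸ k)) ℕ.* suc (n ∸ k)   ≡⟨ cong (λ j → (suc n C j) ℕ.* suc (n ∸ k)) (ℕ.+-∸-assoc 1 k≤n) ⟩
  (suc n C suc (n ∸ k)) ℕ.* suc (n ∸ k)   ≡⟨ [n+1]C[k+1]*[k+1]≡[n+1]*nCk n (n ∸ k) ⟩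
  suc n ℕ.* (n C (n ∸ k))                 ≡⟨ cong (suc n ℕ.*_) (nCk≡nC[n∸k] k≤n) ⟨
  suc n ℕ.* (n C k)                       ∎

surj : ℕ → ℕ → ℕ
surj n k = S2 n k ℕ.* k !

k>n⇒S2nk≡0 : ∀ {n k} → n < k → S2 n k ≡ 0
k>n⇒S2nk≡0 {zero}  {suc k} _         = ≡.refl
k>n⇒S2nk≡0 {suc n} {suc k} (s≤s n<k) = begin
  suc k ℕ.* S2 n (suc k) ℕ.+ S2 n k ≡⟨ cong₂ (λ a b → suc k ℕ.* a ℕ.+ b) (k>n⇒S2nk≡0 (ℕ.m<n⇒m<1+n n<k)) (k>n⇒S2nk≡0 n<k) ⟩
  suc k ℕ.* 0 ℕ.+ 0                 ≡⟨ cong (ℕ._+ 0) (ℕ.*-zeroʳ (suc k)) ⟩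
  0                                 ∎

surj-suc : ∀ n k → surj (suc n) (suc k) ≡ suc k ℕ.* (surj n (suc k) ℕ.+ surj n k)
surj-suc n k = distribute (suc k) (S2 n (suc k)) (S2 n k) (k !)
  where
  distribute : ∀ s a b f → (s ℕ.* a ℕ.+ b) ℕ.* (s ℕ.* f) ≡ s ℕ.* (a ℕ.* (s ℕ.* f) ℕ.+ b ℕ.* f)
  distribute = ℕ-Solver.solve-∀

module ℤ-Identities where

  open import Data.Integer.Base using (_+_; _*_; -_; _-_)
  open import Algebra.Properties.CommutativeSemigroup ℤ.*-commutativeSemigroup using (x∙yz≈y∙xz)

  module ℤ-Sum = FiniteSum.Properties ℤ.+-*-commutativeRing sumℤ (λ _ → ≡.refl) (λ _ _ → ≡.refl)

  sgn*sgn[n∸m]≡sgn : ∀ {m n} → m ≤ n → sgn m * sgn (n ∸ m) ≡ sgn n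
  sgn*sgn[n∸m]≡sgn {m} {n} m≤n = begin
    sgn m * sgn (n ∸ m) ≡⟨ ℤ.^-distribˡ-+-* -1ℤ m (n ∸ m) ⟨
    sgn (m ℕ.+ (n ∸ m)) ≡⟨ cong sgn (ℕ.m+[n∸m]≡n m≤n) ⟩
    sgn n               ∎

  der-suc : ∀ m → der (suc m) ≡ + suc m * der m + sgn (suc m)
  der-suc m = cong₂ _+_ (trans (ℤ-Sum.sum-cong m absorb) (sym (ℤ-Sum.*-distribˡ-sum m (+ suc m) _))) last
    where
    _!/_! : ℕ → ℕ → ℕ
    m !/ i ! = ℕ._/_ (m !) (i !) {{i !≢0}}
    absorb : ∀ i → i ≤ m → sgn i * + (suc m !/ i !) ≡ + suc m * (sgn i * + (m !/ i !))
    absorb i i≤m = begin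
      sgn i * + (suc m !/ i !)            ≡⟨ cong (λ t → sgn i * + t) (*-/-assoc (suc m) {{i !≢0}} (m≤n⇒m!∣n! i≤m)) ⟩
      sgn i * + (suc m ℕ.* (m !/ i !))    ≡⟨ cong (sgn i *_) (ℤ.pos-* (suc m) _) ⟩
      sgn i * (+ suc m * + (m !/ i !))    ≡⟨ x∙yz≈y∙xz (sgn i) (+ suc m) _ ⟩
      + suc m * (sgn i * + (m !/ i !))    ∎
    last : sgn (suc m) * + (suc m !/ suc m !) ≡ sgn (suc m)
    last = trans (cong (λ t → sgn (suc m) * + t) (n/n≡1 (suc m !) {{suc m !≢0}})) (ℤ.*-identityʳ _)

  *-distrib-absorbing : ∀ c s a b d e → c ℕ.* s ≡ a ℕ.* b →
                        + c * (+ s * d + e) ≡ + a * (+ b * d) + + c * e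
  *-distrib-absorbing c s a b d e cs≡ab = begin
    + c * (+ s * d + e)         ≡⟨ ℤ.*-distribˡ-+ (+ c) (+ s * d) e ⟩
    + c * (+ s * d) + + c * e   ≡⟨ cong (_+ + c * e) (ℤ.*-assoc (+ c) (+ s) d) ⟨
    + c * + s * d + + c * e     ≡⟨ cong (λ t → t * d + + c * e) (ℤ.pos-* c s) ⟨
    + (c ℕ.* s) * d + + c * e   ≡⟨ cong (λ t → + t * d + + c * e) cs≡ab ⟩
    + (a ℕ.* b) * d + + c * e   ≡⟨ cong (λ t → t * d + + c * e) (ℤ.pos-* a b) ⟩
    + a * + b * d + + c * e     ≡⟨ cong (_+ + c * e) (ℤ.*-assoc (+ a) (+ b) d) ⟩
    + a * (+ b * d) + + c * e   ∎

  alternating-binomial-sum : ∀ m → sumℤ (suc m) (λ j → + (suc m C j) * sgn j) ≡ 0ℤ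
  alternating-binomial-sum m = begin
    sumℤ (suc m) (λ j → + (suc m C j) * sgn j)          ≡⟨ ℤ-Sum.sum-shift m _ ⟩
    1ℤ + sumℤ m (λ i → + (suc m C suc i) * sgn (suc i))  ≡⟨ cong (_+_ 1ℤ) (ℤ-Sum.sum-cong m (λ i _ → pascal i)) ⟩
    1ℤ + sumℤ m (λ i → g (suc i) - g i)                  ≡⟨ cong (_+_ 1ℤ) (ℤ-Sum.sum-telescope m g) ⟩
    1ℤ + (g (suc m) - 1ℤ)                                ≡⟨ cong (λ t → 1ℤ + (+ t * sgn (suc m) - 1ℤ)) (k>n⇒nCk≡0 (ℕ.n<1+n m)) ⟩
    0ℤ                                                   ∎
    where
    g : ℕ → ℤ
    g i = + (m C i) * sgn i
    pascal : ∀ i → + (suc m C suc i) * sgn (suc i) ≡ g (suc i) - g i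
    pascal i = begin
      + (suc m C suc i) * sgn (suc i)              ≡⟨ cong (λ t → + t * sgn (suc i)) (nCk+nC[k+1]≡[n+1]C[k+1] m i) ⟨
      + (m C i ℕ.+ m C suc i) * (-1ℤ * sgn i)      ≡⟨ cong (_* (-1ℤ * sgn i)) (ℤ.pos-+ (m C i) (m C suc i)) ⟩
      (+ (m C i) + + (m C suc i)) * (-1ℤ * sgn i)  ≡⟨ rearrange (+ (m C i)) (+ (m C suc i)) (sgn i) ⟩
      g (suc i) - g i                              ∎
      where
      rearrange : ∀ a b s → (a + b) * (-1ℤ * s) ≡ b * (-1ℤ * s) - a * s
      rearrange = ℤ-Solver.solve-∀

  binomial-der-sum : ∀ m → sumℤ m (λ r → + (m C r) * der r) ≡ + (m !)
  binomial-der-sum zero    = ≡.refl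
  binomial-der-sum (suc m) = begin
    sumℤ (suc m) (λ r → + (suc m C r) * der r)
      ≡⟨ ℤ-Sum.sum-shift m _ ⟩
    1ℤ + sumℤ m (λ i → + (suc m C suc i) * der (suc i))
      ≡⟨ cong (_+_ 1ℤ) (ℤ-Sum.sum-cong m (λ i _ → step i)) ⟩
    1ℤ + sumℤ m (λ i → + suc m * (+ (m C i) * der i) + alt i)
      ≡⟨ cong (_+_ 1ℤ) (ℤ-Sum.sum-distrib-+ m _ alt) ⟩
    1ℤ + (sumℤ m (λ i → + suc m * (+ (m C i) * der i)) + sumℤ m alt)
      ≡⟨ cong (λ t → 1ℤ + (t + sumℤ m alt)) (ℤ-Sum.*-distribˡ-sum m (+ suc m) _) ⟨
    1ℤ + (+ suc m * sumℤ m (λ i → + (m C i) * der i) + sumℤ m alt)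
      ≡⟨ cong (λ t → 1ℤ + (+ suc m * t + sumℤ m alt)) (binomial-der-sum m) ⟩
    1ℤ + (+ suc m * + (m !) + sumℤ m alt)
      ≡⟨ rearrange (+ suc m * + (m !)) (sumℤ m alt) ⟩
    + suc m * + (m !) + (1ℤ + sumℤ m alt)
      ≡⟨ cong (_+_ (+ suc m * + (m !))) (trans (sym (ℤ-Sum.sum-shift m _)) (alternating-binomial-sum m)) ⟩
    + suc m * + (m !) + 0ℤ
      ≡⟨ ℤ.+-identityʳ _ ⟩
    + suc m * + (m !)
      ≡⟨ ℤ.pos-* (suc m) (m !) ⟨
    + (suc m !)
      ∎
    where
    alt : ℕ → ℤ
    alt i = + (suc m C suc i) * sgn (suc i)
    step : ∀ i → + (suc m C suc i) * der (suc i) ≡ + suc m * (+ (m C i) * der i) + alt i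
    step i = trans (cong (+ (suc m C suc i) *_) (der-suc i))
                   (*-distrib-absorbing (suc m C suc i) (suc i) (suc m) (m C i) (der i) (sgn (suc i))
                     ([n+1]C[k+1]*[k+1]≡[n+1]*nCk m i))
    rearrange : ∀ x y → 1ℤ + (x + y) ≡ x + (1ℤ + y)
    rearrange = ℤ-Solver.solve-∀

  binomialConv : (ℕ → ℤ) → (ℕ → ℤ) → ℕ → ℤ
  binomialConv u v k = sumℤ k (λ r → u r * (+ (k C r) * v (k ∸ r)))

  binomialConv-suc : ∀ u v e → (∀ m → v (suc m) ≡ + suc m * v m + e (suc m)) → v 0 ≡ e 0 →
                     ∀ k → binomialConv u v (suc k) ≡ + suc k * binomialConv u v k + binomialConv u e (suc k)
  binomialConv-suc u v e v-suc v0≡e0 k = begin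
    sumℤ k (λ r → u r * (+ (suc k C r) * v (suc k ∸ r))) + u (suc k) * (+ (suc k C suc k) * v (k ∸ k))
      ≡⟨ cong₂ _+_ (ℤ-Sum.sum-cong k step) (cong (λ t → u (suc k) * (+ (suc k C suc k) * t)) v[k∸k]≡e[k∸k]) ⟩
    sumℤ k (λ r → + suc k * vTerm r + eTerm r) + eTerm (suc k)
      ≡⟨ cong (_+ eTerm (suc k)) (ℤ-Sum.sum-distrib-+ k _ eTerm) ⟩
    sumℤ k (λ r → + suc k * vTerm r) + sumℤ k eTerm + eTerm (suc k)
      ≡⟨ cong (λ t → t + sumℤ k eTerm + eTerm (suc k)) (ℤ-Sum.*-distribˡ-sum k (+ suc k) vTerm) ⟨
    + suc k * binomialConv u v k + sumℤ k eTerm + eTerm (suc k)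
      ≡⟨ ℤ.+-assoc (+ suc k * binomialConv u v k) (sumℤ k eTerm) (eTerm (suc k)) ⟩
    + suc k * binomialConv u v k + binomialConv u e (suc k) ∎
    where
    vTerm eTerm : ℕ → ℤ
    vTerm r = u r * (+ (k C r) * v (k ∸ r))
    eTerm r = u r * (+ (suc k C r) * e (suc k ∸ r))
    v[k∸k]≡e[k∸k] : v (k ∸ k) ≡ e (k ∸ k)
    v[k∸k]≡e[k∸k] rewrite ℕ.n∸n≡0 k = v0≡e0
    step : ∀ r → r ≤ k → u r * (+ (suc k C r) * v (suc k ∸ r)) ≡ + suc k * vTerm r + eTerm r
    step r r≤k = begin
      u r * (+ (suc k C r) * v (suc k ∸ r))
        ≡⟨ cong (λ t → u r * (+ (suc k C r) * v t)) k+1-r≡suc[k-r] ⟩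
      u r * (+ (suc k C r) * v (suc (k ∸ r)))
        ≡⟨ cong (λ t → u r * (+ (suc k C r) * t)) (v-suc (k ∸ r)) ⟩
      u r * (+ (suc k C r) * (+ suc (k ∸ r) * v (k ∸ r) + e (suc (k ∸ r))))
        ≡⟨ cong (u r *_) (*-distrib-absorbing (suc k C r) (suc (k ∸ r)) (suc k) (k C r) (v (k ∸ r)) (e (suc (k ∸ r)))
                            ([n+1]Ck*[n-k+1]≡[n+1]*nCk r≤k)) ⟩
      u r * (+ suc k * (+ (k C r) * v (k ∸ r)) + + (suc k C r) * e (suc (k ∸ r)))
        ≡⟨ ℤ.*-distribˡ-+ (u r) _ _ ⟩
      u r * (+ suc k * (+ (k C r) * v (k ∸ r))) + u r * (+ (suc k C r) * e (suc (k ∸ r)))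
        ≡⟨ cong₂ _+_ (x∙yz≈y∙xz (u r) (+ suc k) (+ (k C r) * v (k ∸ r)))
                     (cong (λ t → u r * (+ (suc k C r) * e t)) (sym k+1-r≡suc[k-r])) ⟩
      + suc k * vTerm r + eTerm r ∎
      where
      k+1-r≡suc[k-r] : suc k ∸ r ≡ suc (k ∸ r)
      k+1-r≡suc[k-r] = ℕ.+-∸-assoc 1 r≤k

  signedDer : ℕ → ℤ
  signedDer r = sgn r * der r

  binomialConv-signedDer-sgn : ∀ m → binomialConv signedDer sgn m ≡ sgn m * + (m !)
  binomialConv-signedDer-sgn m = begin
    binomialConv signedDer sgn m                 ≡⟨ ℤ-Sum.sum-cong m (λ r r≤m → term r r≤m) ⟩
    sumℤ m (λ r → sgn m * (+ (m C r) * der r))  ≡⟨ ℤ-Sum.*-distribˡ-sum m (sgn m) _ ⟨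
    sgn m * sumℤ m (λ r → + (m C r) * der r)    ≡⟨ cong (sgn m *_) (binomial-der-sum m) ⟩
    sgn m * + (m !)                              ∎
    where
    rearrange : ∀ s d c t → s * d * (c * t) ≡ s * t * (c * d)
    rearrange = ℤ-Solver.solve-∀
    term : ∀ r → r ≤ m → signedDer r * (+ (m C r) * sgn (m ∸ r)) ≡ sgn m * (+ (m C r) * der r)
    term r r≤m = trans (rearrange (sgn r) (der r) (+ (m C r)) (sgn (m ∸ r)))
                       (cong (_* (+ (m C r) * der r)) (sgn*sgn[n∸m]≡sgn r≤m))

  -- T k = k! [k even], doubled to avoid an evenness indicator.
  2*binomialConv-signedDer-der : ∀ k → + 2 * binomialConv signedDer der k ≡ + (k !) * (1ℤ + sgn k)
  2*binomialConv-signedDer-der zero    = ≡.refl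
  2*binomialConv-signedDer-der (suc k) = begin
    + 2 * T (suc k)
      ≡⟨ cong (_*_ (+ 2)) (binomialConv-suc signedDer der sgn der-suc ≡.refl k) ⟩
    + 2 * (+ suc k * T k + binomialConv signedDer sgn (suc k))
      ≡⟨ cong (λ t → + 2 * (+ suc k * T k + t)) (binomialConv-signedDer-sgn (suc k)) ⟩
    + 2 * (+ suc k * T k + sgn (suc k) * + (suc k !))
      ≡⟨ cong (λ t → + 2 * (+ suc k * T k + sgn (suc k) * t)) (ℤ.pos-* (suc k) (k !)) ⟩
    + 2 * (+ suc k * T k + -1ℤ * sgn k * (+ suc k * + (k !)))
      ≡⟨ expand (+ suc k) (T k) (sgn k) (+ (k !)) ⟩
    + suc k * (+ 2 * T k) - + 2 * sgn k * (+ suc k * + (k !))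
      ≡⟨ cong (λ t → + suc k * t - + 2 * sgn k * (+ suc k * + (k !))) (2*binomialConv-signedDer-der k) ⟩
    + suc k * (+ (k !) * (1ℤ + sgn k)) - + 2 * sgn k * (+ suc k * + (k !))
      ≡⟨ collect (+ suc k) (+ (k !)) (sgn k) ⟩
    + suc k * + (k !) * (1ℤ + -1ℤ * sgn k)
      ≡⟨ cong (_* (1ℤ + sgn (suc k))) (ℤ.pos-* (suc k) (k !)) ⟨
    + (suc k !) * (1ℤ + sgn (suc k))
      ∎
    where
    T : ℕ → ℤ
    T = binomialConv signedDer der
    expand : ∀ n t s f → + 2 * (n * t + -1ℤ * s * (n * f)) ≡ n * (+ 2 * t) - + 2 * s * (n * f)
    expand = ℤ-Solver.solve-∀
    collect : ∀ n f s → n * (f * (1ℤ + s)) - + 2 * s * (n * f) ≡ n * f * (1ℤ + -1ℤ * s)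
    collect = ℤ-Solver.solve-∀

  -- With-abstraction over r ≤ᵇ k would also rewrite the copy of that test inside k C r,
  -- so derKR is unfolded through derKRᵇ, whose right-hand sides hide behind the Bool.
  private
    derKRᵇ : ℕ → ℕ → Bool → ℤ
    derKRᵇ k r true  = + (k C r) * der (k ∸ r)
    derKRᵇ k r false = 0ℤ

    derKR≡derKRᵇ : ∀ k r → derKR k r ≡ derKRᵇ k r (r ℕ.≤ᵇ k)
    derKR≡derKRᵇ k r with r ℕ.≤ᵇ k
    ... | true  = ≡.refl
    ... | false = ≡.refl

  derKR-≤ : ∀ {k r} → r ≤ k → derKR k r ≡ + (k C r) * der (k ∸ r)
  derKR-≤ {k} {r} r≤k = trans (derKR≡derKRᵇ k r) (cong (derKRᵇ k r) (dec-true (r ℕ.≤? k) r≤k))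

  derKR-> : ∀ {k r} → k < r → derKR k r ≡ 0ℤ
  derKR-> {k} {r} k<r = trans (derKR≡derKRᵇ k r) (cong (derKRᵇ k r) (dec-false (r ℕ.≤? k) (ℕ.<⇒≱ k<r)))

  sum-signedDer-derKR : ∀ {k n} → k ≤ n → sumℤ n (λ r → signedDer r * derKR k r) ≡ binomialConv signedDer der k
  sum-signedDer-derKR {k} {n} k≤n = begin
    sumℤ n (λ r → signedDer r * derKR k r)  ≡⟨ ℤ-Sum.sum-truncate _ k≤n vanish ⟩
    sumℤ k (λ r → signedDer r * derKR k r)  ≡⟨ ℤ-Sum.sum-cong k (λ r r≤k → cong (signedDer r *_) (derKR-≤ r≤k)) ⟩
    binomialConv signedDer der k             ∎
    where
    vanish : ∀ r → k < r → signedDer r * derKR k r ≡ 0ℤ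
    vanish r k<r = trans (cong (signedDer r *_) (derKR-> k<r)) (ℤ.*-zeroʳ (signedDer r))

  2*sum-signedDer-S2-derKR : ∀ {k n} → k ≤ n →
    + 2 * sumℤ n (λ r → signedDer r * (+ S2 n k * derKR k r)) ≡ + surj n k * (1ℤ + sgn k)
  2*sum-signedDer-S2-derKR {k} {n} k≤n = begin
    + 2 * sumℤ n (λ r → signedDer r * (+ S2 n k * derKR k r))
      ≡⟨ cong (_*_ (+ 2)) (ℤ-Sum.sum-cong n (λ r _ → x∙yz≈y∙xz (signedDer r) (+ S2 n k) (derKR k r))) ⟩
    + 2 * sumℤ n (λ r → + S2 n k * (signedDer r * derKR k r))
      ≡⟨ cong (_*_ (+ 2)) (ℤ-Sum.*-distribˡ-sum n (+ S2 n k) _) ⟨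
    + 2 * (+ S2 n k * sumℤ n (λ r → signedDer r * derKR k r))
      ≡⟨ cong (λ t → + 2 * (+ S2 n k * t)) (sum-signedDer-derKR k≤n) ⟩
    + 2 * (+ S2 n k * binomialConv signedDer der k)
      ≡⟨ x∙yz≈y∙xz (+ 2) (+ S2 n k) _ ⟩
    + S2 n k * (+ 2 * binomialConv signedDer der k)
      ≡⟨ cong (_*_ (+ S2 n k)) (2*binomialConv-signedDer-der k) ⟩
    + S2 n k * (+ (k !) * (1ℤ + sgn k))
      ≡⟨ ℤ.*-assoc (+ S2 n k) (+ (k !)) _ ⟨
    + S2 n k * + (k !) * (1ℤ + sgn k)
      ≡⟨ cong (_* (1ℤ + sgn k)) (ℤ.pos-* (S2 n k) (k !)) ⟨
    + surj n k * (1ℤ + sgn k)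
      ∎

  alternating-surj-sum : ∀ n → sumℤ n (λ k → + surj n k * sgn k) ≡ sgn n
  alternating-surj-sum zero    = ≡.refl
  alternating-surj-sum (suc n) = begin
    sumℤ (suc n) (λ k → + surj (suc n) k * sgn k)
      ≡⟨ ℤ-Sum.sum-shift n _ ⟩
    0ℤ + sumℤ n (λ k → + surj (suc n) (suc k) * sgn (suc k))
      ≡⟨ ℤ.+-identityˡ _ ⟩
    sumℤ n (λ k → + surj (suc n) (suc k) * sgn (suc k))
      ≡⟨ ℤ-Sum.sum-cong n (λ k _ → step k) ⟩
    sumℤ n (λ k → (g (suc k) - g k) + -1ℤ * G k)
      ≡⟨ ℤ-Sum.sum-distrib-+ n _ _ ⟩
    sumℤ n (λ k → g (suc k) - g k) + sumℤ n (λ k → -1ℤ * G k)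
      ≡⟨ cong₂ _+_ (ℤ-Sum.sum-telescope n g) (sym (ℤ-Sum.*-distribˡ-sum n -1ℤ G)) ⟩
    (g (suc n) - 0ℤ) + -1ℤ * sumℤ n G
      ≡⟨ cong₂ (λ a b → (a - 0ℤ) + -1ℤ * b) g[n+1]≡0 (alternating-surj-sum n) ⟩
    0ℤ + -1ℤ * sgn n
      ≡⟨ ℤ.+-identityˡ _ ⟩
    sgn (suc n)
      ∎
    where
    G g : ℕ → ℤ
    G k = + surj n k * sgn k
    g k = + k * G k
    g[n+1]≡0 : g (suc n) ≡ 0ℤ
    g[n+1]≡0 = trans (cong (λ a → + suc n * (+ (a ℕ.* suc n !) * sgn (suc n))) (k>n⇒S2nk≡0 (ℕ.n<1+n n)))
                     (ℤ.*-zeroʳ (+ suc n))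
    regroup : ∀ k a b s → (1ℤ + k) * (a + b) * (-1ℤ * s)
                        ≡ ((1ℤ + k) * (a * (-1ℤ * s)) - k * (b * s)) + -1ℤ * (b * s)
    regroup = ℤ-Solver.solve-∀
    step : ∀ k → + surj (suc n) (suc k) * sgn (suc k) ≡ (g (suc k) - g k) + -1ℤ * G k
    step k = begin
      + surj (suc n) (suc k) * sgn (suc k)
        ≡⟨ cong (λ t → + t * sgn (suc k)) (surj-suc n k) ⟩
      + (suc k ℕ.* (surj n (suc k) ℕ.+ surj n k)) * sgn (suc k)
        ≡⟨ cong (_* sgn (suc k)) (trans (ℤ.pos-* (suc k) _) (cong (_*_ (+ suc k)) (ℤ.pos-+ (surj n (suc k)) (surj n k)))) ⟩
      + suc k * (+ surj n (suc k) + + surj n k) * (-1ℤ * sgn k)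
        ≡⟨ regroup (+ k) (+ surj n (suc k)) (+ surj n k) (sgn k) ⟩
      (g (suc k) - g k) + -1ℤ * G k
        ∎

open ℤ-Identities

open import Data.Nat.Coprimality using (1-coprimeTo) renaming (sym to coprime-sym)
open import Data.Maybe.Base using (nothing)
open import Data.Rational.Base using (ℚ; mkℚ; _+_; _*_; -_; ½; 1ℚ)
import Data.Rational.Properties as ℚ
open import Data.Product using (_×_; _,_)
import Data.Integer
import Tactic.RingSolver as RingSolver
import Tactic.RingSolver.Core.AlmostCommutativeRing as ACR

module ℚ-Sum = FiniteSum.Properties ℚ.+-*-commutativeRing sumℚ (λ _ → ≡.refl) (λ _ _ → ≡.refl)

ℚ-ring : ACR.AlmostCommutativeRing _ _
ℚ-ring = ACR.fromCommutativeRing ℚ.+-*-commutativeRing (λ _ → nothing)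

-- toℚ z = z / 1 is a gcd normalisation that only computes for closed z; on the normal form
-- mkℚ z 0 the operations of ℚ compute, so the homomorphism laws hold by conversion.
private
  ⟦_⟧ : ℤ → ℚ
  ⟦ z ⟧ = mkℚ z 0 (coprime-sym (1-coprimeTo ℤ.∣ z ∣))

  toℚ≡⟦⟧ : ∀ z → toℚ z ≡ ⟦ z ⟧
  toℚ≡⟦⟧ z = ℚ.↥p/↧p≡p ⟦ z ⟧

toℚ-+ : ∀ a b → toℚ (a ℤ.+ b) ≡ toℚ a + toℚ b
toℚ-+ a b = begin
  toℚ (a ℤ.+ b)                      ≡⟨ cong₂ (λ x y → toℚ (x ℤ.+ y)) (ℤ.*-identityʳ a) (ℤ.*-identityʳ b) ⟨
  toℚ (a ℤ.* + 1 ℤ.+ b ℤ.* + 1)      ≡⟨⟩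
  ⟦ a ⟧ + ⟦ b ⟧                       ≡⟨ cong₂ _+_ (toℚ≡⟦⟧ a) (toℚ≡⟦⟧ b) ⟨
  toℚ a + toℚ b                      ∎

toℚ-* : ∀ a b → toℚ (a ℤ.* b) ≡ toℚ a * toℚ b
toℚ-* a b = sym (cong₂ _*_ (toℚ≡⟦⟧ a) (toℚ≡⟦⟧ b))

toℚ-sum : ∀ n f → toℚ (sumℤ n f) ≡ sumℚ n (λ i → toℚ (f i))
toℚ-sum zero    f = ≡.refl
toℚ-sum (suc n) f = trans (toℚ-+ (sumℤ n f) (f (suc n))) (cong (_+ toℚ (f (suc n))) (toℚ-sum n f))

toℚ≡½*toℚ[2*] : ∀ z → toℚ z ≡ ½ * toℚ (+ 2 ℤ.* z)
toℚ≡½*toℚ[2*] z = begin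
  toℚ z                   ≡⟨ ℚ.*-identityˡ (toℚ z) ⟨
  ½ * toℚ (+ 2) * toℚ z   ≡⟨ ℚ.*-assoc ½ (toℚ (+ 2)) (toℚ z) ⟩
  ½ * (toℚ (+ 2) * toℚ z) ≡⟨ cong (½ *_) (toℚ-* (+ 2) z) ⟨
  ½ * toℚ (+ 2 ℤ.* z)     ∎

[-y]^ℚk≡sgn*y^ℚk : ∀ y k → (- y) ^ℚ k ≡ toℚ (sgn k) * y ^ℚ k
[-y]^ℚk≡sgn*y^ℚk y zero    = ≡.refl
[-y]^ℚk≡sgn*y^ℚk y (suc k) = begin
  - y * (- y) ^ℚ k                     ≡⟨ cong (- y *_) ([-y]^ℚk≡sgn*y^ℚk y k) ⟩
  - y * (toℚ (sgn k) * y ^ℚ k)         ≡⟨ rearrange y (toℚ (sgn k)) (y ^ℚ k) ⟩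
  - 1ℚ * toℚ (sgn k) * (y * y ^ℚ k)    ≡⟨ cong (_* (y * y ^ℚ k)) (toℚ-* -1ℤ (sgn k)) ⟨
  toℚ (sgn (suc k)) * (y * y ^ℚ k)     ∎
  where
  rearrange : ∀ y s Y → - y * (s * Y) ≡ - 1ℚ * s * (y * Y)
  rearrange = RingSolver.solve-∀ ℚ-ring

[-1]^ℚk≡sgn : ∀ k → (- 1ℚ) ^ℚ k ≡ toℚ (sgn k)
[-1]^ℚk≡sgn zero    = ≡.refl
[-1]^ℚk≡sgn (suc k) = trans (cong (- 1ℚ *_) ([-1]^ℚk≡sgn k)) (sym (toℚ-* -1ℤ (sgn k)))

w[n,-1]≡sgn : ∀ n → w n (- 1ℚ) ≡ toℚ (sgn n)
w[n,-1]≡sgn n = begin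
  w n (- 1ℚ)                                  ≡⟨ ℚ-Sum.sum-cong n (λ k _ → cong (toℚ (+ surj n k) *_) ([-1]^ℚk≡sgn k)) ⟩
  sumℚ n (λ k → toℚ (+ surj n k) * toℚ (sgn k)) ≡⟨ ℚ-Sum.sum-cong n (λ k _ → toℚ-* (+ surj n k) (sgn k)) ⟨
  sumℚ n (λ k → toℚ (+ surj n k ℤ.* sgn k))    ≡⟨ toℚ-sum n _ ⟨
  toℚ (sumℤ n (λ k → + surj n k ℤ.* sgn k))    ≡⟨ cong toℚ (alternating-surj-sum n) ⟩
  toℚ (sgn n)                                 ∎

signedDer-wt-sum : ∀ n y → sumℚ n (λ r → toℚ (signedDer r) * wt n r y) ≡ ½ * (w n y + w n (- y))
signedDer-wt-sum n y = begin
  sumℚ n (λ r → toℚ (signedDer r) * wt n r y)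
    ≡⟨ ℚ-Sum.sum-*-sum n n (λ r → toℚ (signedDer r)) (λ r k → toℚ (+ S2 n k ℤ.* derKR k r)) (y ^ℚ_) ⟩
  sumℚ n (λ k → sumℚ n (λ r → toℚ (signedDer r) * toℚ (+ S2 n k ℤ.* derKR k r)) * y ^ℚ k)
    ≡⟨ ℚ-Sum.sum-cong n (λ k k≤n → cong (_* y ^ℚ k) (coefficient k≤n)) ⟩
  sumℚ n (λ k → ½ * (F k * (1ℚ + toℚ (sgn k))) * y ^ℚ k)
    ≡⟨ ℚ-Sum.sum-cong n (λ k _ → even-part k) ⟩
  sumℚ n (λ k → ½ * (F k * y ^ℚ k + F k * (- y) ^ℚ k))
    ≡⟨ ℚ-Sum.*-distribˡ-sum n ½ _ ⟨
  ½ * sumℚ n (λ k → F k * y ^ℚ k + F k * (- y) ^ℚ k)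
    ≡⟨ cong (½ *_) (ℚ-Sum.sum-distrib-+ n _ _) ⟩
  ½ * (w n y + w n (- y))
    ∎
  where
  F : ℕ → ℚ
  F k = toℚ (+ surj n k)
  coefficient : ∀ {k} → k ≤ n →
    sumℚ n (λ r → toℚ (signedDer r) * toℚ (+ S2 n k ℤ.* derKR k r)) ≡ ½ * (F k * (1ℚ + toℚ (sgn k)))
  coefficient {k} k≤n = begin
    sumℚ n (λ r → toℚ (signedDer r) * toℚ (+ S2 n k ℤ.* derKR k r))
      ≡⟨ ℚ-Sum.sum-cong n (λ r _ → toℚ-* (signedDer r) _) ⟨
    sumℚ n (λ r → toℚ (signedDer r ℤ.* (+ S2 n k ℤ.* derKR k r)))
      ≡⟨ toℚ-sum n _ ⟨
    toℚ (sumℤ n (λ r → signedDer r ℤ.* (+ S2 n k ℤ.* derKR k r)))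
      ≡⟨ toℚ≡½*toℚ[2*] (sumℤ n (λ r → signedDer r ℤ.* (+ S2 n k ℤ.* derKR k r))) ⟩
    ½ * toℚ (+ 2 ℤ.* sumℤ n (λ r → signedDer r ℤ.* (+ S2 n k ℤ.* derKR k r)))
      ≡⟨ cong (λ t → ½ * toℚ t) (2*sum-signedDer-S2-derKR k≤n) ⟩
    ½ * toℚ (+ surj n k ℤ.* (1ℤ ℤ.+ sgn k))
      ≡⟨ cong (½ *_) (trans (toℚ-* (+ surj n k) _) (cong (F k *_) (toℚ-+ 1ℤ (sgn k)))) ⟩
    ½ * (F k * (1ℚ + toℚ (sgn k)))
      ∎
  rearrange : ∀ h f s Y → h * (f * (1ℚ + s)) * Y ≡ h * (f * Y + f * (s * Y))
  rearrange = RingSolver.solve-∀ ℚ-ring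
  even-part : ∀ k → ½ * (F k * (1ℚ + toℚ (sgn k))) * y ^ℚ k ≡ ½ * (F k * y ^ℚ k + F k * (- y) ^ℚ k)
  even-part k = trans (rearrange ½ (F k) (toℚ (sgn k)) (y ^ℚ k))
                      (cong (λ t → ½ * (F k * y ^ℚ k + F k * t)) (sym ([-y]^ℚk≡sgn*y^ℚk y k)))

mainTheorem14 : (∀ (n : ℕ) (y : ℚ) →
                    sumℚ n (λ r → toℚ (sgn r Data.Integer.* der r) * wt n r y)
                      ≡ ½ * (w n y + w n (- y)))
                  × (∀ (n : ℕ) →
                    (sumℚ n (λ r → toℚ (sgn r Data.Integer.* der r) * wtOne n r)
                      ≡ sumℚ n (λ r → toℚ (sgn r Data.Integer.* der r) * wt n r (- 1ℚ)))
                    × (sumℚ n (λ r → toℚ (sgn r Data.Integer.* der r) * wtOne n r)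
                      ≡ ½ * (wBell n + toℚ (sgn n))))
mainTheorem14 = signedDer-wt-sum , λ n → symmetric n , at-one n
  where
  symmetric : ∀ n → sumℚ n (λ r → toℚ (signedDer r) * wt n r 1ℚ) ≡ sumℚ n (λ r → toℚ (signedDer r) * wt n r (- 1ℚ))
  symmetric n = begin
    sumℚ n (λ r → toℚ (signedDer r) * wt n r 1ℚ)    ≡⟨ signedDer-wt-sum n 1ℚ ⟩
    ½ * (w n 1ℚ + w n (- 1ℚ))                        ≡⟨ cong (½ *_) (ℚ.+-comm (w n 1ℚ) (w n (- 1ℚ))) ⟩
    ½ * (w n (- 1ℚ) + w n (- (- 1ℚ)))                ≡⟨ signedDer-wt-sum n (- 1ℚ) ⟨
    sumℚ n (λ r → toℚ (signedDer r) * wt n r (- 1ℚ)) ∎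
  at-one : ∀ n → sumℚ n (λ r → toℚ (signedDer r) * wt n r 1ℚ) ≡ ½ * (wBell n + toℚ (sgn n))
  at-one n = trans (signedDer-wt-sum n 1ℚ) (cong (λ t → ½ * (wBell n + t)) (w[n,-1]≡sgn n))
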